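{- Let $(T_n)_{n\ge 0}$ be the Tribonacci sequence. If positive integers $n,\ell,m,d$ with $1\le d\le 9$ and $m\ge 2$ satisfy $$(T_{n}-1)(T_{n+1}-1)\cdots (T_{n+\ell-1}-1)=d\left(\frac{10^{m}-1}{9}\right),$$ then $\ell\leq 6$.
   Context: The Tribonacci sequence is defined by $T_0=0$, $T_1=T_2=1$ and $T_{n+3}=T_{n+2}+T_{n+1}+T_n$ for all $n\ge 0$. -}

module Defs where

open import Data.Nat using (ℕ; zero; suc; _+_; _*_; _∸_)

T : ℕ → ℕ
T 0 = 0
T 1 = 1
T 2 = 1
T (suc (suc (suc n))) = T (suc (suc n)) + T (suc n) + T n

-- prodShift n ℓ = (T n - 1)(T (n+1) - 1) ... (T (n+ℓ-1) - 1)
-- (truncated subtraction is harmless: T k ≥ 1 for k ≥ 1, and n ≥ 1 in the statement)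
prodShift : ℕ → ℕ → ℕ
prodShift n zero = 1
prodShift n (suc ℓ) = (T n ∸ 1) * prodShift (suc n) ℓ

{-# OPTIONS --safe #-}
-- The numbers s k = T k ∸ 1 (k ≥ 1) satisfy s (k+3) = s (k+2) + s (k+1) + s k + 2, so their residues
-- modulo 16 are periodic with period 32, and inspecting one period shows that any seven
-- consecutive ones multiply to 0 modulo 16.  On the other side the repunit (10 ^ m ∸ 1) / 9
-- is odd, so 16 ∣ d * repunit forces 16 ∣ d, which is impossible for 1 ≤ d ≤ 9.
module Submission where

open import Defs
open import Data.Nat using (ℕ; zero; suc; _+_; _*_; _∸_; _^_; _%_; _≤_; _<_; _>_; pred; NonZero; z≤n; s≤s; _≤?_; _≟_)
open import Data.Nat.Properties using (≤-trans; m≤m+n; ≰⇒>; m+[n∸m]≡n; +-comm; *-comm; +-assoc; allUpTo?)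
open import Data.Nat.DivMod using (_/_; %-distribˡ-+; %-distribˡ-*; m%n%n≡m%n; m*n/n≡m; m≡m%n+[m/n]*n; m%n<n)
open import Data.Nat.Divisibility
  using (_∣_; _∣?_; divides; divides-refl; 1∣_; ∣-trans; m∣m*n; m*n∣⇒m∣; ∣m+n∣m⇒∣n; ∣⇒≤;
         *-monoʳ-∣; *-cancelˡ-∣; m%n≡0⇒n∣m)
open import Data.Nat.Primality using (Prime; prime[2]; euclidsLemma; prime⇒nonZero)
open import Data.Nat.Tactic.RingSolver using (solve-∀)
open import Data.Sum using (inj₁; inj₂)
open import Function using (force; force-≡)
open import Relation.Nullary using (¬_; yes; no; contradiction)
open import Relation.Nullary.Decidable using (from-yes; from-no)
open import Relation.Binary.PropositionalEquality using (_≡_; refl; sym; trans; cong; cong₂; subst; module ≡-Reasoning)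

T[1+k]>0 : ∀ k → T (suc k) > 0
T[1+k]>0 zero = s≤s z≤n
T[1+k]>0 (suc zero) = s≤s z≤n
T[1+k]>0 (suc (suc k)) = ≤-trans (T[1+k]>0 (suc k)) (≤-trans (m≤m+n _ _) (m≤m+n _ _))

pred[m+n+o] : ∀ {m n o} → m > 0 → n > 0 → o > 0 → pred (m + n + o) ≡ pred m + pred n + pred o + 2
pred[m+n+o] {suc m} {suc n} {suc o} _ _ _ = normalise m n o
  where
  normalise : ∀ a b c → a + suc b + suc c ≡ a + b + c + 2
  normalise = solve-∀

pred-T-rec : ∀ k → pred (T (4 + k)) ≡ pred (T (3 + k)) + pred (T (2 + k)) + pred (T (1 + k)) + 2
pred-T-rec k = pred[m+n+o] (T[1+k]>0 (2 + k)) (T[1+k]>0 (1 + k)) (T[1+k]>0 k)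

module Residues (M : ℕ) .{{_ : NonZero M}} where

  %-cong-+ : ∀ {a b c d} → a % M ≡ b % M → c % M ≡ d % M → (a + c) % M ≡ (b + d) % M
  %-cong-+ {a} {b} {c} {d} a≡b c≡d = begin
    (a + c) % M             ≡⟨ %-distribˡ-+ a c M ⟩
    (a % M + c % M) % M     ≡⟨ cong₂ (λ x y → (x + y) % M) a≡b c≡d ⟩
    (b % M + d % M) % M     ≡⟨ sym (%-distribˡ-+ b d M) ⟩
    (b + d) % M             ∎
    where open ≡-Reasoning

  -- A data type rather than a product: with η for records, step would unfold on a neutral
  -- window, and checking orbit[32+k] would build exponentially large terms.
  data Window : Set where
    ⟨_,_,_⟩ : ℕ → ℕ → ℕ → Window

  leading : Window → ℕ
  leading ⟨ a , _ , _ ⟩ = a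

  -- The normaliser does not share, so without force evaluating orbit 32 takes exponential time.
  step : Window → Window
  step ⟨ a , b , c ⟩ = force ((c + b + a + 2) % M) λ z → ⟨ b , c , z ⟩

  step-unfold : ∀ a b c → step ⟨ a , b , c ⟩ ≡ ⟨ b , c , (c + b + a + 2) % M ⟩
  step-unfold a b c = force-≡ ((c + b + a + 2) % M) λ z → ⟨ b , c , z ⟩

  orbit : ℕ → Window
  orbit zero = ⟨ 0 % M , 0 % M , 1 % M ⟩
  orbit (suc k) = step (orbit k)

  orbit-correct : ∀ k → orbit k ≡ ⟨ pred (T (1 + k)) % M , pred (T (2 + k)) % M , pred (T (3 + k)) % M ⟩
  orbit-correct zero = refl
  orbit-correct (suc k) = begin
    step (orbit k)                       ≡⟨ cong step (orbit-correct k) ⟩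
    step ⟨ a % M , b % M , c % M ⟩       ≡⟨ step-unfold (a % M) (b % M) (c % M) ⟩
    ⟨ b % M , c % M , (c % M + b % M + a % M + 2) % M ⟩
      ≡⟨ cong (λ x → ⟨ b % M , c % M , x ⟩) (%-cong-+ (%-cong-+ (%-cong-+ (reduce c) (reduce b)) (reduce a)) refl) ⟩
    ⟨ b % M , c % M , (c + b + a + 2) % M ⟩ ≡⟨ cong (λ x → ⟨ b % M , c % M , x % M ⟩) (sym (pred-T-rec k)) ⟩
    ⟨ b % M , c % M , pred (T (4 + k)) % M ⟩ ∎
    where
    open ≡-Reasoning
    a b c : ℕ
    a = pred (T (1 + k))
    b = pred (T (2 + k))
    c = pred (T (3 + k))
    reduce : ∀ x → x % M % M ≡ x % M
    reduce x = m%n%n≡m%n x M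

  leadingProduct : ℕ → Window → ℕ
  leadingProduct zero w = 1 % M
  leadingProduct (suc ℓ) w = (leading w * leadingProduct ℓ (step w)) % M

  prodShift%M : ∀ k ℓ → prodShift (suc k) ℓ % M ≡ leadingProduct ℓ (orbit k)
  prodShift%M k zero = refl
  prodShift%M k (suc ℓ) = begin
    (pred (T (suc k)) * prodShift (2 + k) ℓ) % M
      ≡⟨ %-distribˡ-* (pred (T (suc k))) (prodShift (2 + k) ℓ) M ⟩
    (pred (T (suc k)) % M * (prodShift (2 + k) ℓ % M)) % M
      ≡⟨ cong₂ (λ x y → (x * y) % M) (sym (cong leading (orbit-correct k))) (prodShift%M (suc k) ℓ) ⟩
    (leading (orbit k) * leadingProduct ℓ (orbit (suc k))) % M ∎
    where open ≡-Reasoning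

open Residues 16

orbit[32+k] : ∀ k → orbit (32 + k) ≡ orbit k
orbit[32+k] zero = refl
orbit[32+k] (suc k) = cong step (orbit[32+k] k)

orbit-periodic : ∀ q j → orbit (q * 32 + j) ≡ orbit j
orbit-periodic zero j = refl
orbit-periodic (suc q) j = begin
  orbit (32 + q * 32 + j)   ≡⟨ cong orbit (+-assoc 32 (q * 32) j) ⟩
  orbit (32 + (q * 32 + j)) ≡⟨ orbit[32+k] (q * 32 + j) ⟩
  orbit (q * 32 + j)        ≡⟨ orbit-periodic q j ⟩
  orbit j                   ∎
  where open ≡-Reasoning

orbit≡orbit[k%32] : ∀ k → orbit k ≡ orbit (k % 32)
orbit≡orbit[k%32] k = begin
  orbit k                          ≡⟨ cong orbit (trans (m≡m%n+[m/n]*n k 32) (+-comm (k % 32) _)) ⟩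
  orbit (k / 32 * 32 + k % 32)     ≡⟨ orbit-periodic (k / 32) (k % 32) ⟩
  orbit (k % 32)                   ∎
  where open ≡-Reasoning

leadingProduct-7≡0 : ∀ k → leadingProduct 7 (orbit k) ≡ 0
leadingProduct-7≡0 k = trans (cong (leadingProduct 7) (orbit≡orbit[k%32] k)) (onePeriod (m%n<n k 32))
  where
  onePeriod : ∀ {j} → j < 32 → leadingProduct 7 (orbit j) ≡ 0
  onePeriod = from-yes (allUpTo? (λ j → leadingProduct 7 (orbit j) ≟ 0) 32)

prodShift∣prodShift-+ : ∀ n ℓ j → prodShift n ℓ ∣ prodShift n (ℓ + j)
prodShift∣prodShift-+ n zero j = 1∣ _
prodShift∣prodShift-+ n (suc ℓ) j = *-monoʳ-∣ (pred (T n)) (prodShift∣prodShift-+ (suc n) ℓ j)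

16∣prodShift : ∀ k ℓ → 7 ≤ ℓ → 16 ∣ prodShift (suc k) ℓ
16∣prodShift k ℓ 7≤ℓ = subst (λ i → 16 ∣ prodShift (suc k) i) (m+[n∸m]≡n 7≤ℓ)
  (∣-trans 16∣seven (prodShift∣prodShift-+ (suc k) 7 (ℓ ∸ 7)))
  where
  16∣seven : 16 ∣ prodShift (suc k) 7
  16∣seven = m%n≡0⇒n∣m _ 16 (trans (prodShift%M k 7) (leadingProduct-7≡0 k))

repunit : ℕ → ℕ
repunit zero = 0
repunit (suc m) = 1 + 10 * repunit m

10^m≡1+repunit*9 : ∀ m → 10 ^ m ≡ 1 + repunit m * 9
10^m≡1+repunit*9 zero = refl
10^m≡1+repunit*9 (suc m) = trans (cong (10 *_) (10^m≡1+repunit*9 m)) (normalise (repunit m))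
  where
  normalise : ∀ r → 10 * (1 + r * 9) ≡ 1 + (1 + 10 * r) * 9
  normalise = solve-∀

[10^m∸1]/9≡repunit : ∀ m → (10 ^ m ∸ 1) / 9 ≡ repunit m
[10^m∸1]/9≡repunit m = trans (cong (λ x → (x ∸ 1) / 9) (10^m≡1+repunit*9 m)) (m*n/n≡m (repunit m) 9)

repunit-odd : ∀ m → ¬ 2 ∣ repunit (suc m)
repunit-odd m 2∣1+10r = from-no (2 ∣? 1) (∣m+n∣m⇒∣n 2∣10r+1 2∣10r)
  where
  2∣10r : 2 ∣ 10 * repunit m
  2∣10r = ∣-trans (divides 5 refl) (m∣m*n (repunit m))
  2∣10r+1 : 2 ∣ 10 * repunit m + 1
  2∣10r+1 = subst (2 ∣_) (+-comm 1 _) 2∣1+10r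

p^k∣m*n⇒p^k∣m : ∀ {p} k {m n} → Prime p → ¬ p ∣ n → p ^ k ∣ m * n → p ^ k ∣ m
p^k∣m*n⇒p^k∣m zero pr p∤n _ = 1∣ _
p^k∣m*n⇒p^k∣m {p} (suc k) {m} {n} pr p∤n p^[1+k]∣mn with euclidsLemma m n pr (m*n∣⇒m∣ p (p ^ k) p^[1+k]∣mn)
... | inj₂ p∣n = contradiction p∣n p∤n
... | inj₁ (divides-refl q) = subst (p ^ suc k ∣_) (*-comm p q) (*-monoʳ-∣ p p^k∣q)
  where
  p^k∣q : p ^ k ∣ q
  p^k∣q = p^k∣m*n⇒p^k∣m k pr p∤n
    (*-cancelˡ-∣ p {{prime⇒nonZero pr}} (subst (p ^ suc k ∣_) (reassociate q p n) p^[1+k]∣mn))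
    where
    reassociate : ∀ a b c → a * b * c ≡ b * (a * c)
    reassociate = solve-∀

lemma8 : (n ℓ m d : ℕ) → 1 ≤ n → 1 ≤ ℓ → 1 ≤ d → d ≤ 9 → 2 ≤ m →
    prodShift n ℓ ≡ d * ((10 ^ m ∸ 1) / 9) → ℓ ≤ 6
lemma8 (suc n) ℓ (suc m) (suc d) _ _ _ d≤9 _ eq with ℓ ≤? 6
... | yes ℓ≤6 = ℓ≤6
... | no ℓ≰6 = contradiction (≤-trans (∣⇒≤ 16∣d) d≤9) (from-no (16 ≤? 9))
  where
  16∣d*repunit : 16 ∣ suc d * repunit (suc m)
  16∣d*repunit = subst (16 ∣_) (trans eq (cong (suc d *_) ([10^m∸1]/9≡repunit (suc m))))
    (16∣prodShift n ℓ (≰⇒> ℓ≰6))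
  16∣d : 16 ∣ suc d
  16∣d = p^k∣m*n⇒p^k∣m 4 prime[2] (repunit-odd m) 16∣d*repunit
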